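{- The clairvoyance gap for scheduling on related machines is $\Omega(\sqrt m)$, where $m$ is the number of machines.
   Context: Scheduling on related machines: $m$ machines with speeds $s_i>0$, jobs with sizes $p_j\ge0$; assigning job $j$ to machine $i$ adds $p_j/s_i$ to the load of $i$; the makespan is the maximum load. A non-clairvoyant algorithm has no prior knowledge of job sizes and decides where to place each job using only current machine loads and speeds; after each assignment, an adversary chooses the job's realized size, which the algorithm then observes. The clairvoyance gap is the maximum (over instances with $m$ machines) ratio between the makespan of an optimal non-clairvoyant algorithm and the optimal makespan of a clairvoyant offline algorithm knowing all jobs and sizes in advance. -}

module Defs where

open import Data.Nat using (ℕ; zero; suc)
open import Data.Fin using (Fin; zero; suc)
import Data.Fin as Fin
open import Data.List using (List; []; _∷_; foldr; map; allFin)
open import Data.Vec using (Vec; []; _∷_)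
open import Data.Rational using (ℚ; 0ℚ; _+_; _÷_; _⊔_; _≤_; _≟_; ≢-nonZero)
open import Data.Product using (Σ; _×_)
open import Relation.Nullary using (yes; no; does)
open import Relation.Binary.PropositionalEquality using (_≡_)
open import Data.Bool using (if_then_else_)

Loads : ℕ → Set
Loads m = Fin m → ℚ

emptyLoads : ∀ {m} → Loads m
emptyLoads _ = 0ℚ

-- p / s  (processing time of a job of size p on a machine of speed s);
-- the s = 0 branch is never used since speeds are assumed positive
divQ : ℚ → ℚ → ℚ
divQ p s with s ≟ 0ℚ
... | yes _ = 0ℚ
... | no s≢0 = _÷_ p s {{≢-nonZero s≢0}}

addLoad : ∀ {m} → Loads m → Fin m → ℚ → Loads m
addLoad ℓ i x j = if does (i Fin.≟ j) then ℓ j + x else ℓ j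

-- makespan = maximum load (loads are nonnegative, so base 0 is harmless)
makespan : ∀ {m} → Loads m → ℚ
makespan {m} ℓ = foldr _⊔_ 0ℚ (map ℓ (allFin m))

-- A non-clairvoyant algorithm (for fixed speeds) chooses the machine for the
-- next job using only the current machine loads.
NCAlg : ℕ → Set
NCAlg m = Loads m → Fin m

-- Run a non-clairvoyant algorithm: each job is placed by the algorithm, then
-- its size (chosen by the adversary) is revealed and added to the load.
runNC : ∀ {m n} → (Fin m → ℚ) → NCAlg m → Loads m → Vec ℚ n → Loads m
runNC s alg ℓ [] = ℓ
runNC s alg ℓ (x ∷ xs) =
  runNC s alg (addLoad ℓ (alg ℓ) (divQ x (s (alg ℓ)))) xs

ncMakespan : ∀ {m n} → (Fin m → ℚ) → NCAlg m → Vec ℚ n → ℚ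
ncMakespan s alg p = makespan (runNC s alg emptyLoads p)

assignLoads : ∀ {m n} → (Fin m → ℚ) → Vec ℚ n → (Fin n → Fin m) → Loads m
assignLoads s [] σ = emptyLoads
assignLoads s (x ∷ xs) σ =
  addLoad (assignLoads s xs (λ j → σ (suc j))) (σ zero) (divQ x (s (σ zero)))

IsOptMakespan : ∀ {m n} → (Fin m → ℚ) → Vec ℚ n → ℚ → Set
IsOptMakespan {m} {n} s p v =
  Σ (Fin n → Fin m) (λ σ → makespan (assignLoads s p σ) ≡ v)
  × ((σ : Fin n → Fin m) → v ≤ makespan (assignLoads s p σ))

-- Take one fast machine of speed K ≈ √m and m − 1 slow machines of speed 1.
-- As long as the algorithm puts every job on the fast machine, the adversary
-- makes it a job of size K, raising the fast load by 1.  The first job put on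
-- a slow machine, or else the last job, gets size K², and all later jobs size 0.
-- Then either a slow machine carries K², or the fast machine ends with load
-- m − 1 + K ≥ K²; so ALG ≥ K².  Offline, the K² job fits on the fast machine
-- and the fewer than m jobs of size K on distinct slow machines, so OPT = K.
module Submission where

open import Defs
open import Data.Nat using (ℕ)
import Data.Nat as ℕ
open import Data.Fin using (Fin)
open import Data.Vec using (Vec)
open import Data.Vec.Relation.Unary.All using (All)
open import Data.Rational using (ℚ; 0ℚ; _≤_; _<_; _*_; _/_)
open import Data.Integer using (+_)
open import Data.Product using (_×_; ∃-syntax)

open import Data.Nat using (zero; suc; z≤n; s≤s)
import Data.Nat.Properties as ℕₚ
open import Data.Nat.Solver using (module +-*-Solver)
open import Data.Fin using (zero; suc; toℕ; fromℕ<)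
import Data.Fin as Fin
open import Data.Fin.Properties using (toℕ-fromℕ<; suc-injective)
open import Data.Vec using ([]; _∷_; replicate; lookup; map)
open import Data.Vec.Relation.Unary.All using ([]; _∷_)
open import Data.List using (foldr; allFin)
import Data.List as List
open import Data.List.Membership.Propositional using (_∈_)
open import Data.List.Membership.Propositional.Properties using (∈-allFin)
open import Data.List.Relation.Unary.Any using (here; there)
open import Data.Rational using (1ℚ; ½; _+_; _⊔_; 1/_; _≟_; toℚᵘ; fromℚᵘ; NonZero; NonNegative; positive; nonNegative; ≢-nonZero)
open import Data.Rational.Properties
import Data.Rational.Unnormalised as ℚᵘ
import Data.Rational.Unnormalised.Properties as ℚᵘₚ
import Data.Integer as ℤ
import Data.Integer.Properties as ℤₚ
open import Data.Product using (_,_; proj₁; proj₂)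
open import Data.Empty using (⊥-elim)
open import Relation.Nullary using (yes; no; ¬_)
open import Relation.Binary.PropositionalEquality
open import Function using (_∘_)

ι : ℕ → ℚ
ι n = + n / 1

ιᵘ : ℕ → ℚᵘ.ℚᵘ
ιᵘ n = ℚᵘ.mkℚᵘ (+ n) 0

fromℚᵘ-homo-+ : ∀ p q → fromℚᵘ (p ℚᵘ.+ q) ≡ fromℚᵘ p + fromℚᵘ q
fromℚᵘ-homo-+ p q = toℚᵘ-injective (begin
  toℚᵘ (fromℚᵘ (p ℚᵘ.+ q))                    ≈⟨ toℚᵘ-fromℚᵘ (p ℚᵘ.+ q) ⟩
  p ℚᵘ.+ q                                    ≈⟨ ℚᵘₚ.+-cong (ℚᵘₚ.≃-sym (toℚᵘ-fromℚᵘ p)) (ℚᵘₚ.≃-sym (toℚᵘ-fromℚᵘ q)) ⟩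
  toℚᵘ (fromℚᵘ p) ℚᵘ.+ toℚᵘ (fromℚᵘ q)         ≈⟨ ℚᵘₚ.≃-sym (toℚᵘ-homo-+ (fromℚᵘ p) (fromℚᵘ q)) ⟩
  toℚᵘ (fromℚᵘ p + fromℚᵘ q)                  ∎)
  where open ℚᵘₚ.≃-Reasoning

fromℚᵘ-homo-* : ∀ p q → fromℚᵘ (p ℚᵘ.* q) ≡ fromℚᵘ p * fromℚᵘ q
fromℚᵘ-homo-* p q = toℚᵘ-injective (begin
  toℚᵘ (fromℚᵘ (p ℚᵘ.* q))                    ≈⟨ toℚᵘ-fromℚᵘ (p ℚᵘ.* q) ⟩
  p ℚᵘ.* q                                    ≈⟨ ℚᵘₚ.*-cong (ℚᵘₚ.≃-sym (toℚᵘ-fromℚᵘ p)) (ℚᵘₚ.≃-sym (toℚᵘ-fromℚᵘ q)) ⟩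
  toℚᵘ (fromℚᵘ p) ℚᵘ.* toℚᵘ (fromℚᵘ q)         ≈⟨ ℚᵘₚ.≃-sym (toℚᵘ-homo-* (fromℚᵘ p) (fromℚᵘ q)) ⟩
  toℚᵘ (fromℚᵘ p * fromℚᵘ q)                  ∎)
  where open ℚᵘₚ.≃-Reasoning

fromℚᵘ-mono-≤ : ∀ {p q} → p ℚᵘ.≤ q → fromℚᵘ p ≤ fromℚᵘ q
fromℚᵘ-mono-≤ {p} {q} p≤q = toℚᵘ-cancel-≤ (begin
  toℚᵘ (fromℚᵘ p)  ≃⟨ toℚᵘ-fromℚᵘ p ⟩
  p                ≤⟨ p≤q ⟩
  q                ≃⟨ ℚᵘₚ.≃-sym (toℚᵘ-fromℚᵘ q) ⟩
  toℚᵘ (fromℚᵘ q)  ∎)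
  where open ℚᵘₚ.≤-Reasoning

ι-+ : ∀ a b → ι (a ℕ.+ b) ≡ ι a + ι b
ι-+ a b = trans (fromℚᵘ-cong {ιᵘ (a ℕ.+ b)} {ιᵘ a ℚᵘ.+ ιᵘ b} (ℚᵘ.*≡* (cong (ℤ._* + 1) ι+)))
                (fromℚᵘ-homo-+ (ιᵘ a) (ιᵘ b))
  where
  ι+ : + (a ℕ.+ b) ≡ + a ℤ.* + 1 ℤ.+ + b ℤ.* + 1
  ι+ = trans (ℤₚ.pos-+ a b) (sym (cong₂ ℤ._+_ (ℤₚ.*-identityʳ (+ a)) (ℤₚ.*-identityʳ (+ b))))

ι-* : ∀ a b → ι (a ℕ.* b) ≡ ι a * ι b
ι-* a b = trans (fromℚᵘ-cong {ιᵘ (a ℕ.* b)} {ιᵘ a ℚᵘ.* ιᵘ b} (ℚᵘ.*≡* (cong (ℤ._* + 1) (ℤₚ.pos-* a b))))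
                (fromℚᵘ-homo-* (ιᵘ a) (ιᵘ b))

ι-mono-≤ : ∀ {a b} → a ℕ.≤ b → ι a ≤ ι b
ι-mono-≤ {a} {b} a≤b = fromℚᵘ-mono-≤ {ιᵘ a} {ιᵘ b} (ℚᵘ.*≤* (ℤₚ.*-monoʳ-≤-nonNeg (+ 1) (ℤ.+≤+ a≤b)))

suc-square≤4*square : ∀ {k} → 1 ℕ.≤ k → suc k ℕ.* suc k ℕ.≤ 4 ℕ.* (k ℕ.* k)
suc-square≤4*square {k} 1≤k = begin
  suc k ℕ.* suc k          ≤⟨ ℕₚ.*-mono-≤ suc-k≤2k suc-k≤2k ⟩
  (k ℕ.+ k) ℕ.* (k ℕ.+ k)  ≡⟨ solve 1 (λ k → (k :+ k) :* (k :+ k) := con 4 :* (k :* k)) refl k ⟩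
  4 ℕ.* (k ℕ.* k)          ∎
  where
  open ℕₚ.≤-Reasoning
  open +-*-Solver
  suc-k≤2k : suc k ℕ.≤ k ℕ.+ k
  suc-k≤2k = subst (ℕ._≤ k ℕ.+ k) (ℕₚ.+-comm k 1) (ℕₚ.+-monoʳ-≤ k 1≤k)

square-bracket : ∀ n → ∃[ k ] (1 ℕ.≤ k × k ℕ.* k ℕ.≤ suc n × suc n ℕ.≤ 4 ℕ.* (k ℕ.* k))
square-bracket zero = 1 , ℕₚ.≤-refl , ℕₚ.≤-refl , s≤s z≤n
square-bracket (suc n) with square-bracket n
... | k , 1≤k , k²≤1+n , 1+n≤4k² with suc k ℕ.* suc k ℕₚ.≤? suc (suc n)
...   | yes [k+1]²≤2+n = suc k , s≤s z≤n , [k+1]²≤2+n ,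
          ℕₚ.≤-trans (s≤s 1+n≤4k²) (ℕₚ.*-monoʳ-< 4 (ℕₚ.*-mono-< (ℕₚ.n<1+n k) (ℕₚ.n<1+n k)))
...   | no [k+1]²≰2+n = k , 1≤k , ℕₚ.m≤n⇒m≤1+n k²≤1+n ,
          ℕₚ.≤-trans (ℕₚ.<⇒≤ (ℕₚ.≰⇒> [k+1]²≰2+n)) (suc-square≤4*square 1≤k)

p≤p+q : ∀ {p q} → 0ℚ ≤ q → p ≤ p + q
p≤p+q {p} {q} 0≤q = subst (_≤ p + q) (+-identityʳ p) (+-monoʳ-≤ p 0≤q)

p≤q+p : ∀ {p q} → 0ℚ ≤ q → p ≤ q + p
p≤q+p {p} {q} 0≤q = subst (p ≤_) (+-comm p q) (p≤p+q 0≤q)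

addLoad-self : ∀ {m} (ℓ : Loads m) i x → addLoad ℓ i x i ≡ ℓ i + x
addLoad-self ℓ i x with i Fin.≟ i
... | yes _ = refl
... | no i≢i = ⊥-elim (i≢i refl)

addLoad-other : ∀ {m} (ℓ : Loads m) {i j} x → ¬ i ≡ j → addLoad ℓ i x j ≡ ℓ j
addLoad-other ℓ {i} {j} x i≢j with i Fin.≟ j
... | yes i≡j = ⊥-elim (i≢j i≡j)
... | no _ = refl

addLoad-0 : ∀ {m} (ℓ : Loads m) i j → addLoad ℓ i 0ℚ j ≡ ℓ j
addLoad-0 ℓ i j with i Fin.≟ j
... | yes _ = +-identityʳ (ℓ j)
... | no _ = refl

addLoad-mono : ∀ {m} (ℓ : Loads m) i {x} → 0ℚ ≤ x → ∀ j → ℓ j ≤ addLoad ℓ i x j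
addLoad-mono ℓ i {x} 0≤x j with i Fin.≟ j
... | yes _ = p≤p+q 0≤x
... | no _ = ≤-refl

foldr-⊔-≥ : ∀ {A : Set} (f : A → ℚ) {xs x} → x ∈ xs → f x ≤ foldr _⊔_ 0ℚ (List.map f xs)
foldr-⊔-≥ f {y List.∷ _} (here refl) = p≤p⊔q (f y) _
foldr-⊔-≥ f {y List.∷ _} (there x∈xs) = p≤q⇒p≤r⊔q (f y) (foldr-⊔-≥ f x∈xs)

foldr-⊔-≤ : ∀ {A : Set} (f : A → ℚ) xs {b} → 0ℚ ≤ b → (∀ x → f x ≤ b) → foldr _⊔_ 0ℚ (List.map f xs) ≤ b
foldr-⊔-≤ f List.[] 0≤b f≤b = 0≤b
foldr-⊔-≤ f (x List.∷ xs) 0≤b f≤b = ⊔-lub (f≤b x) (foldr-⊔-≤ f xs 0≤b f≤b)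

load≤makespan : ∀ {m} (ℓ : Loads m) i → ℓ i ≤ makespan ℓ
load≤makespan ℓ i = foldr-⊔-≥ ℓ (∈-allFin i)

makespan≤ : ∀ {m} (ℓ : Loads m) {b} → 0ℚ ≤ b → (∀ i → ℓ i ≤ b) → makespan ℓ ≤ b
makespan≤ {m} ℓ = foldr-⊔-≤ ℓ (allFin m)

divQ-nonNeg : ∀ {x s} → 0ℚ ≤ x → 0ℚ < s → 0ℚ ≤ divQ x s
divQ-nonNeg {x} {s} 0≤x 0<s with s ≟ 0ℚ
... | yes _ = ≤-refl
... | no s≢0 = nonNegative⁻¹ (x * 1/s) {{nonNeg*nonNeg⇒nonNeg x {{nonNegative 0≤x}} 1/s {{1/s-nonNeg}}}}
  where
  1/s : ℚ
  1/s = (1/ s) {{≢-nonZero s≢0}}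
  1/s-nonNeg : NonNegative 1/s
  1/s-nonNeg = pos⇒nonNeg 1/s {{1/pos⇒pos s {{positive 0<s}}}}

divQ-*-cancelʳ : ∀ x {s} → 0ℚ < s → divQ (x * s) s ≡ x
divQ-*-cancelʳ x {s} 0<s with s ≟ 0ℚ
... | yes s≡0 = ⊥-elim (<⇒≢ 0<s (sym s≡0))
... | no s≢0 = begin
  x * s * 1/ s    ≡⟨ *-assoc x s (1/ s) ⟩
  x * (s * 1/ s)  ≡⟨ cong (x *_) (*-inverseʳ s) ⟩
  x * 1ℚ          ≡⟨ *-identityʳ x ⟩
  x               ∎
  where
  open ≡-Reasoning
  instance
    s-nonZero : NonZero s
    s-nonZero = ≢-nonZero s≢0

divQ-self : ∀ {s} → 0ℚ < s → divQ s s ≡ 1ℚ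
divQ-self {s} 0<s = trans (cong (λ x → divQ x s) (sym (*-identityˡ s))) (divQ-*-cancelʳ 1ℚ 0<s)

divQ-zero : ∀ s → divQ 0ℚ s ≡ 0ℚ
divQ-zero s with s ≟ 0ℚ
... | yes _ = refl
... | no s≢0 = *-zeroˡ ((1/ s) {{≢-nonZero s≢0}})

divQ-one : ∀ x → divQ x 1ℚ ≡ x
divQ-one = *-identityʳ

module _ {m} (s : Fin m → ℚ) (s-pos : ∀ i → 0ℚ < s i) where

  assignLoads-nonNeg : ∀ {n} {p : Vec ℚ n} → All (0ℚ ≤_) p → ∀ σ i → 0ℚ ≤ assignLoads s p σ i
  assignLoads-nonNeg [] σ i = ≤-refl
  assignLoads-nonNeg {p = x ∷ p} (0≤x ∷ 0≤p) σ i =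
    ≤-trans (assignLoads-nonNeg 0≤p (σ ∘ suc) i)
            (addLoad-mono (assignLoads s p (σ ∘ suc)) (σ zero) (divQ-nonNeg 0≤x (s-pos (σ zero))) i)

  job≤assignLoads : ∀ {n} {p : Vec ℚ n} → All (0ℚ ≤_) p → ∀ σ t →
                    divQ (lookup p t) (s (σ t)) ≤ assignLoads s p σ (σ t)
  job≤assignLoads {p = x ∷ p} (_ ∷ 0≤p) σ zero =
    subst (divQ x (s (σ zero)) ≤_) (sym (addLoad-self (assignLoads s p (σ ∘ suc)) (σ zero) _))
          (p≤q+p (assignLoads-nonNeg 0≤p (σ ∘ suc) (σ zero)))
  job≤assignLoads {p = x ∷ p} (0≤x ∷ 0≤p) σ (suc t) =
    ≤-trans (job≤assignLoads 0≤p (σ ∘ suc) t)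
            (addLoad-mono (assignLoads s p (σ ∘ suc)) (σ zero) (divQ-nonNeg 0≤x (s-pos (σ zero))) (σ (suc t)))

  runNC-mono : ∀ alg ℓ {n} {xs : Vec ℚ n} → All (0ℚ ≤_) xs → ∀ i → ℓ i ≤ runNC s alg ℓ xs i
  runNC-mono alg ℓ [] i = ≤-refl
  runNC-mono alg ℓ {xs = x ∷ _} (0≤x ∷ 0≤xs) i =
    ≤-trans (addLoad-mono ℓ (alg ℓ) (divQ-nonNeg 0≤x (s-pos (alg ℓ))) i)
            (runNC-mono alg (addLoad ℓ (alg ℓ) (divQ x (s (alg ℓ)))) 0≤xs i)

  placed≤makespan : ∀ alg ℓ i x {n} {xs : Vec ℚ n} → All (0ℚ ≤_) xs →
                    ℓ i + divQ x (s i) ≤ makespan (runNC s alg (addLoad ℓ i (divQ x (s i))) xs)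
  placed≤makespan alg ℓ i x {xs = xs} 0≤xs =
    ≤-trans (≤-reflexive (sym (addLoad-self ℓ i (divQ x (s i)))))
            (≤-trans (runNC-mono alg ℓ′ 0≤xs i) (load≤makespan (runNC s alg ℓ′ xs) i))
    where ℓ′ = addLoad ℓ i (divQ x (s i))

sizes : ∀ {A : Set} {n} → Vec (ℚ × A) n → Vec ℚ n
sizes = map proj₁

placement : ∀ {A : Set} {n} → Vec (ℚ × A) n → Fin n → A
placement v t = proj₂ (lookup v t)

module Adversary (M : ℕ) (K : ℚ) (1≤K : 1ℚ ≤ K) where

  0<K : 0ℚ < K
  0<K = <-≤-trans (positive⁻¹ 1ℚ) 1≤K

  0≤K : 0ℚ ≤ K
  0≤K = <⇒≤ 0<K

  K≤K*K : K ≤ K * K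
  K≤K*K = subst (_≤ K * K) (*-identityʳ K) (*-monoˡ-≤-nonNeg K {{nonNegative 0≤K}} 1≤K)

  speed : Fin (suc M) → ℚ
  speed zero = K
  speed (suc _) = 1ℚ

  speed-pos : ∀ i → 0ℚ < speed i
  speed-pos zero = 0<K
  speed-pos (suc _) = positive⁻¹ 1ℚ

  planLoads : ∀ {n} → Vec (ℚ × Fin (suc M)) n → Loads (suc M)
  planLoads v = assignLoads speed (sizes v) (placement v)

  zeros : ∀ n → Vec (ℚ × Fin (suc M)) n
  zeros n = replicate n (0ℚ , zero)

  zeros-nonNeg : ∀ n → All (0ℚ ≤_) (sizes (zeros n))
  zeros-nonNeg zero = []
  zeros-nonNeg (suc n) = ≤-refl ∷ zeros-nonNeg n

  zeros-load : ∀ n i → planLoads (zeros n) i ≡ 0ℚ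
  zeros-load zero i = refl
  zeros-load (suc n) i = begin
    addLoad (planLoads (zeros n)) zero (divQ 0ℚ K) i  ≡⟨ cong (λ x → addLoad (planLoads (zeros n)) zero x i) (divQ-zero K) ⟩
    addLoad (planLoads (zeros n)) zero 0ℚ i           ≡⟨ addLoad-0 (planLoads (zeros n)) zero i ⟩
    planLoads (zeros n) i                             ≡⟨ zeros-load n i ⟩
    0ℚ                                                ∎
    where open ≡-Reasoning

  bigThenZeros : ∀ n → Vec (ℚ × Fin (suc M)) (suc n)
  bigThenZeros n = (K * K , zero) ∷ zeros n

  bigJob-slow : ∀ (ℓ : Loads (suc M)) j → 0ℚ ≤ ℓ (suc j) → K * K ≤ ℓ (suc j) + divQ (K * K) (speed (suc j))
  bigJob-slow ℓ j 0≤ℓ = subst (λ x → K * K ≤ ℓ (suc j) + x) (sym (divQ-one (K * K))) (p≤q+p 0≤ℓ)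

  K≤bigJob : ∀ i → K ≤ divQ (K * K) (speed i)
  K≤bigJob zero    = ≤-reflexive (sym (divQ-*-cancelʳ K 0<K))
  K≤bigJob (suc _) = subst (K ≤_) (sym (divQ-one (K * K))) K≤K*K

  K≤makespan : ∀ {n} {p : Vec ℚ n} → All (0ℚ ≤_) p → ∀ t → lookup p t ≡ K * K →
               ∀ σ → K ≤ makespan (assignLoads speed p σ)
  K≤makespan {p = p} 0≤p t p[t]≡K² σ = begin
    K                                  ≤⟨ K≤bigJob (σ t) ⟩
    divQ (K * K) (speed (σ t))         ≡⟨ cong (λ x → divQ x (speed (σ t))) p[t]≡K² ⟨
    divQ (lookup p t) (speed (σ t))    ≤⟨ job≤assignLoads speed speed-pos 0≤p σ t ⟩
    assignLoads speed p σ (σ t)        ≤⟨ load≤makespan (assignLoads speed p σ) (σ t) ⟩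
    makespan (assignLoads speed p σ)   ∎
    where open ≤-Reasoning

  BoundedAndFreeFrom : ℕ → Loads (suc M) → Set
  BoundedAndFreeFrom r L = (∀ i → L i ≤ K) × (∀ (j : Fin M) → r ℕ.≤ toℕ j → L (suc j) ≡ 0ℚ)

  bigThenZeros-bounded : ∀ n r → BoundedAndFreeFrom r (planLoads (bigThenZeros n))
  bigThenZeros-bounded n r = bounded , λ j _ → zeros-load n (suc j)
    where
    bounded : ∀ i → planLoads (bigThenZeros n) i ≤ K
    bounded zero = ≤-reflexive (begin
      planLoads (zeros n) zero + divQ (K * K) K  ≡⟨ cong₂ _+_ (zeros-load n zero) (divQ-*-cancelʳ K 0<K) ⟩
      0ℚ + K                                     ≡⟨ +-identityˡ K ⟩
      K                                          ∎)
      where open ≡-Reasoning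
    bounded (suc j) = subst (_≤ K) (sym (zeros-load n (suc j))) 0≤K

  place-bounded : ∀ {r L} (j : Fin M) → toℕ j ≡ r → BoundedAndFreeFrom r L →
                  BoundedAndFreeFrom (suc r) (addLoad L (suc j) (divQ K 1ℚ))
  place-bounded {r} {L} j j≡r (L≤K , L-free) = bounded , free
    where
    bounded : ∀ i → addLoad L (suc j) (divQ K 1ℚ) i ≤ K
    bounded i with suc j Fin.≟ i
    ... | yes refl = ≤-reflexive (begin
      L (suc j) + divQ K 1ℚ                  ≡⟨ cong₂ _+_ (L-free j (ℕₚ.≤-reflexive (sym j≡r))) (divQ-one K) ⟩
      0ℚ + K                                 ≡⟨ +-identityˡ K ⟩
      K                                      ∎)
      where open ≡-Reasoning
    ... | no _ = L≤K i
    free : ∀ (j′ : Fin M) → suc r ℕ.≤ toℕ j′ → addLoad L (suc j) (divQ K 1ℚ) (suc j′) ≡ 0ℚ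
    free j′ r<j′ = trans (addLoad-other L (divQ K 1ℚ) (ℕₚ.<⇒≢ r<j′ ∘ trans (sym j≡r) ∘ cong toℕ ∘ suc-injective))
                         (L-free j′ (ℕₚ.<⇒≤ r<j′))

  module _ (alg : NCAlg (suc M)) where

    -- The last r + 1 jobs, for an algorithm facing loads ℓ, each paired with its machine in
    -- the offline schedule: a size-K job followed by r + 1 further jobs goes to slow machine r.
    -- Written as a cons so that runNC unfolds before a proof splits on alg ℓ.
    adversary : (r : ℕ) → r ℕ.≤ M → Loads (suc M) → Vec (ℚ × Fin (suc M)) (suc r)
    adversary zero _ ℓ = bigThenZeros 0
    adversary (suc r) r<M ℓ = nextJob (alg ℓ) ∷ laterJobs (alg ℓ)
      where
      nextJob : Fin (suc M) → ℚ × Fin (suc M)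
      nextJob zero    = K , suc (fromℕ< r<M)
      nextJob (suc _) = K * K , zero
      laterJobs : Fin (suc M) → Vec (ℚ × Fin (suc M)) (suc r)
      laterJobs zero    = adversary r (ℕₚ.<⇒≤ r<M) (addLoad ℓ zero (divQ K K))
      laterJobs (suc _) = zeros (suc r)

    adversary-nonNeg : ∀ r r≤M ℓ → All (0ℚ ≤_) (sizes (adversary r r≤M ℓ))
    adversary-nonNeg zero _ ℓ = ≤-trans 0≤K K≤K*K ∷ []
    adversary-nonNeg (suc r) r<M ℓ with alg ℓ
    ... | zero  = 0≤K ∷ adversary-nonNeg r (ℕₚ.<⇒≤ r<M) (addLoad ℓ zero (divQ K K))
    ... | suc _ = ≤-trans 0≤K K≤K*K ∷ zeros-nonNeg (suc r)

    adversary-online : ∀ r r≤M ℓ → (∀ i → 0ℚ ≤ ℓ i) → K * K ≤ ℓ zero + ι r + K →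
                       K * K ≤ makespan (runNC speed alg ℓ (sizes (adversary r r≤M ℓ)))
    adversary-online zero _ ℓ ℓ≥0 K²≤ with alg ℓ
    ... | zero = ≤-trans (subst (K * K ≤_) (cong₂ _+_ (+-identityʳ (ℓ zero)) (sym (divQ-*-cancelʳ K 0<K))) K²≤)
                         (placed≤makespan speed speed-pos alg ℓ zero (K * K) [])
    ... | suc j = ≤-trans (bigJob-slow ℓ j (ℓ≥0 (suc j))) (placed≤makespan speed speed-pos alg ℓ (suc j) (K * K) [])
    adversary-online (suc r) r<M ℓ ℓ≥0 K²≤ with alg ℓ
    ... | zero = adversary-online r (ℕₚ.<⇒≤ r<M) ℓ′ ℓ′≥0 (subst (λ x → K * K ≤ x + K) fastLoad K²≤)
      where
      ℓ′ = addLoad ℓ zero (divQ K K)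
      ℓ′≥0 : ∀ i → 0ℚ ≤ ℓ′ i
      ℓ′≥0 i = ≤-trans (ℓ≥0 i) (addLoad-mono ℓ zero (divQ-nonNeg 0≤K 0<K) i)
      fastLoad : ℓ zero + ι (suc r) ≡ ℓ zero + divQ K K + ι r
      fastLoad = begin
        ℓ zero + ι (1 ℕ.+ r)     ≡⟨ cong (λ x → ℓ zero + x) (ι-+ 1 r) ⟩
        ℓ zero + (1ℚ + ι r)      ≡⟨ +-assoc (ℓ zero) 1ℚ (ι r) ⟨
        ℓ zero + 1ℚ + ι r        ≡⟨ cong (λ x → ℓ zero + x + ι r) (divQ-self 0<K) ⟨
        ℓ zero + divQ K K + ι r  ∎
        where open ≡-Reasoning
    ... | suc j = ≤-trans (bigJob-slow ℓ j (ℓ≥0 (suc j)))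
                          (placed≤makespan speed speed-pos alg ℓ (suc j) (K * K) (zeros-nonNeg (suc r)))

    adversary-bigJob : ∀ r r≤M ℓ → ∃[ t ] lookup (sizes (adversary r r≤M ℓ)) t ≡ K * K
    adversary-bigJob zero _ ℓ = zero , refl
    adversary-bigJob (suc r) r<M ℓ with alg ℓ
    ... | zero  = let t , p[t]≡K² = adversary-bigJob r (ℕₚ.<⇒≤ r<M) (addLoad ℓ zero (divQ K K))
                  in suc t , p[t]≡K²
    ... | suc _ = zero , refl

    adversary-bounded : ∀ r r≤M ℓ → BoundedAndFreeFrom r (planLoads (adversary r r≤M ℓ))
    adversary-bounded zero _ ℓ = bigThenZeros-bounded 0 0
    adversary-bounded (suc r) r<M ℓ with alg ℓ
    ... | zero  = place-bounded (fromℕ< r<M) (toℕ-fromℕ< r<M)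
                    (adversary-bounded r (ℕₚ.<⇒≤ r<M) (addLoad ℓ zero (divQ K K)))
    ... | suc _ = bigThenZeros-bounded (suc r) (suc r)

  gapInstance : K * K ≤ ι M + K → (alg : NCAlg (suc M)) →
                ∃[ p ] (All (0ℚ ≤_) {suc M} p × IsOptMakespan speed p K × K * K ≤ ncMakespan speed alg p)
  gapInstance K²≤M+K alg =
    sizes plan , 0≤p , ((placement plan , ≤-antisym opt≤K (K≤opt (placement plan))) , K≤opt) ,
    adversary-online alg M ℕₚ.≤-refl emptyLoads (λ _ → ≤-refl)
      (subst (λ x → K * K ≤ x + K) (sym (+-identityˡ (ι M))) K²≤M+K)
    where
    plan = adversary alg M ℕₚ.≤-refl emptyLoads
    0≤p = adversary-nonNeg alg M ℕₚ.≤-refl emptyLoads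
    K≤opt : ∀ σ → K ≤ makespan (assignLoads speed (sizes plan) σ)
    K≤opt = let t , p[t]≡K² = adversary-bigJob alg M ℕₚ.≤-refl emptyLoads in K≤makespan 0≤p t p[t]≡K²
    opt≤K : makespan (planLoads plan) ≤ K
    opt≤K = makespan≤ (planLoads plan) 0≤K (proj₁ (adversary-bounded alg M ℕₚ.≤-refl emptyLoads))

√m-speed : ∀ M → ∃[ K ] (1ℚ ≤ K × K * K ≤ ι M + K × ½ * ½ * ι (suc M) ≤ K * K)
√m-speed M with square-bracket M
... | k , 1≤k , k²≤1+M , 1+M≤4k² = ι k , ι-mono-≤ 1≤k , K²≤M+K , m/4≤K²
  where
  open ≤-Reasoning
  K²≤M+K : ι k * ι k ≤ ι M + ι k
  K²≤M+K = begin
    ι k * ι k      ≡⟨ ι-* k k ⟨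
    ι (k ℕ.* k)    ≤⟨ ι-mono-≤ (ℕₚ.≤-trans k²≤1+M (subst (ℕ._≤ M ℕ.+ k) (ℕₚ.+-comm M 1) (ℕₚ.+-monoʳ-≤ M 1≤k))) ⟩
    ι (M ℕ.+ k)    ≡⟨ ι-+ M k ⟩
    ι M + ι k      ∎
  m/4≤K² : ½ * ½ * ι (suc M) ≤ ι k * ι k
  m/4≤K² = begin
    ½ * ½ * ι (suc M)               ≤⟨ *-monoˡ-≤-nonNeg (½ * ½) (ι-mono-≤ 1+M≤4k²) ⟩
    ½ * ½ * ι (4 ℕ.* (k ℕ.* k))     ≡⟨ cong (½ * ½ *_) (ι-* 4 (k ℕ.* k)) ⟩
    ½ * ½ * (ι 4 * ι (k ℕ.* k))     ≡⟨ *-assoc (½ * ½) (ι 4) (ι (k ℕ.* k)) ⟨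
    ½ * ½ * ι 4 * ι (k ℕ.* k)       ≡⟨ *-identityˡ (ι (k ℕ.* k)) ⟩
    ι (k ℕ.* k)                     ≡⟨ ι-* k k ⟩
    ι k * ι k                       ∎

p*q*q≤r*r : ∀ {p q r} → 0ℚ ≤ q → p ≤ q * q → q * q ≤ r → p * q * q ≤ r * r
p*q*q≤r*r {p} {q} {r} 0≤q p≤q² q²≤r = begin
  p * q * q      ≡⟨ *-assoc p q q ⟩
  p * (q * q)    ≤⟨ *-monoʳ-≤-nonNeg (q * q) {{nonNegative 0≤q²}} (≤-trans p≤q² q²≤r) ⟩
  r * (q * q)    ≤⟨ *-monoˡ-≤-nonNeg r {{nonNegative (≤-trans 0≤q² q²≤r)}} q²≤r ⟩
  r * r          ∎
  where
  open ≤-Reasoning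
  0≤q² : 0ℚ ≤ q * q
  0≤q² = nonNegative⁻¹ (q * q) {{nonNeg*nonNeg⇒nonNeg q {{nonNegative 0≤q}} q {{nonNegative 0≤q}}}}

mainTheorem8 : ∃[ c ] (0ℚ < c × ∃[ m₀ ] ((m : ℕ) → m₀ ℕ.≤ m →
    ∃[ s ] (((i : Fin m) → 0ℚ < s i) × ∃[ n ] ((alg : NCAlg m) →
    ∃[ p ] (All (λ x → 0ℚ ≤ x) {n} p × ∃[ v ] (IsOptMakespan s p v × 0ℚ < v
    × c * c * (+ m / 1) * v * v ≤ ncMakespan s alg p * ncMakespan s alg p))))))
mainTheorem8 = ½ , positive⁻¹ ½ , 1 , λ where
  zero ()
  (suc M) _ →
    let K , 1≤K , K²≤M+K , m/4≤K² = √m-speed M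
        open Adversary M K 1≤K
    in speed , speed-pos , suc M , λ alg →
       let p , 0≤p , opt , K²≤alg = gapInstance K²≤M+K alg
       in p , 0≤p , K , opt , 0<K , p*q*q≤r*r 0≤K m/4≤K² K²≤alg
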